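{- Let $\mathbb{T}$ be a $D$-algebraic theory, $\Omega$ an order bound system of $\mathbb{T}$, and $(L,i)$ an order bound dcpo $\mathbb{T}$-algebra (an object of $\mathbf{DCPO}(\mathbb{T},\Omega)$). If $\{S_j\}_{j\in J}$ is a non-empty family of sub o.b.d.algebras of $(L,i)$, then $\bigcap_{j\in J}S_j$ is a sub o.b.d.algebra of $(L,i)$.
   Context: A $D$-algebraic theory is a tuple $\mathbb{T}=(\Sigma_0,\Sigma_1,\lvert\cdot\rvert,M,\theta,\Lambda)$ where $\Sigma_0,\Sigma_1$ are disjoint sets of operator symbols, $\lvert\cdot\rvert:\Sigma_0\cup\Sigma_1\to\mathbb{N}$ gives arities, $M$ is a set of dcpos, $\theta$ assigns to each pair $(g,k)$ with $g\in\Sigma_1$, $1\le k\le\lvert g\rvert$, either an element of $M$ or the symbol $*$, and $\Lambda$ is a set of laws of the form $e_1\sqsubseteq e_2$ or $e_1=e_2$ between terms built from variables using the operators. An order bound system $\Omega$ of $\mathbb{T}$ assigns to each $f\in\Sigma_0$ a functor $\Omega^f:\mathbf{POS}\to\mathbf{SET}$ such that for each poset $P$, $\Omega^fP\subseteq P^{\lvert f\rvert}$; for each order-preserving $h:P\to Q$, $h^{\lvert f\rvert}(\Omega^fP)\subseteq\Omega^fQ$ (componentwise application), and $\Omega^fh$ is the restriction/co-restriction of $h^{\lvert f\rvert}$. An order bound dcpo $\mathbb{T}$-algebra $(L,i)$ is a dcpo $L$ with: for each $f\in\Sigma_0$ a map $i(f):\Omega^fL\to L$ which is partially Scott continuous (if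 $D\subseteq\Omega^fL$ is directed in the product order and $\bigsqcup D\in\Omega^fL$ then $i(f)(\bigsqcup D)=\bigsqcup i(f)(D)$); for each $g\in\Sigma_1$ a Scott continuous map $i(g):A_{g,1}\times\cdots\times A_{g,\lvert g\rvert}\to L$, where $A_{g,k}=\theta(g,k)$ if $\theta(g,k)\in M$ and $A_{g,k}=L$ if $\theta(g,k)=*$; and such that every equation or inequation deducible from the laws in $\Lambda$ and monotonicity of operations holds whenever every occurrence of each $i(f)$, $f\in\Sigma_0$, in it is applied to a tuple in $\Omega^fL$. A subdcpo of $L$ is a subset closed under sups (in $L$) of its directed subsets. A sub o.b.d.algebra of $(L,i)$ is a subdcpo $S$ of $L$ such that $i(f)(\Omega^fS)\subseteq S$ for all $f\in\Sigma_0$ (where $S$ carries the order induced from $L$) and $i(g)(E_g(S))\subseteq S$ for all $g\in\Sigma_1$, where $E_g(S)$ is the subset of $A_{g,1}\times\cdots\times A_{g,\lvert g\rvert}$ in which every coordinate with $\theta(g,k)=*$ is restricted to lie in $S$. -}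

module Defs where

open import Level using (Level; suc; Lift)
open import Data.Nat using (ℕ)
open import Data.Fin using (Fin)
open import Data.Maybe using (Maybe; just; nothing)
open import Data.Product using (Σ; _×_; ∃; proj₁)
open import Data.Unit using (⊤)
open import Relation.Unary using (Pred; _∈_)
open import Relation.Binary using (Rel; Poset; IsPartialOrder)
open import Relation.Binary.PropositionalEquality using (_≡_)
open import Relation.Binary.Morphism.Bundles using (PosetHomomorphism; mkPosetHomo)
import Relation.Binary.Construct.On as On

Directed : ∀ {a r i} {A : Set a} {I : Set i} → Rel A r → (I → A) → Set _
Directed {I = I} _≤_ d = I × (∀ x y → ∃ λ z → d x ≤ d z × d y ≤ d z)

UpperBound : ∀ {a r i} {A : Set a} {I : Set i} → Rel A r → (I → A) → A → Set _
UpperBound _≤_ d u = ∀ x → d x ≤ u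

IsSup : ∀ {a r i} {A : Set a} {I : Set i} → Rel A r → (I → A) → A → Set _
IsSup {A = A} _≤_ d s = UpperBound _≤_ d s × (∀ (u : A) → UpperBound _≤_ d u → s ≤ u)

record Dcpo (ℓ : Level) : Set (suc ℓ) where
  field
    Carrier        : Set ℓ
    _≤_            : Rel Carrier ℓ
    isPartialOrder : IsPartialOrder _≡_ _≤_
    hasSup         : ∀ {I : Set ℓ} (d : I → Carrier) → Directed _≤_ d → Σ Carrier (IsSup _≤_ d)

  poset : Poset ℓ ℓ ℓ
  poset = record { isPartialOrder = isPartialOrder }

open Dcpo using (Carrier; poset) renaming (_≤_ to ≤⟨_⟩)

SubDcpo : ∀ {ℓ} (L : Dcpo ℓ) → Pred (Carrier L) ℓ → Set (suc ℓ)
SubDcpo {ℓ} L S =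
  ∀ {I : Set ℓ} (d : I → Carrier L) → Directed (≤⟨ L ⟩) d →
  (∀ x → d x ∈ S) → ∀ s → IsSup (≤⟨ L ⟩) d s → s ∈ S

subPoset : ∀ {ℓ} (L : Dcpo ℓ) → Pred (Carrier L) ℓ → Poset ℓ ℓ ℓ
subPoset L S = On.poset (poset L) (proj₁ {B = S})

incl : ∀ {ℓ} (L : Dcpo ℓ) (S : Pred (Carrier L) ℓ) → PosetHomomorphism (subPoset L S) (poset L)
incl L S = mkPosetHomo (subPoset L S) (poset L) proj₁ (λ p → p)

-- Operator symbols Σ₀, Σ₁ (disjoint: two separate types), arities,
-- the set M of dcpos (indexed by a type M), and θ (nothing = *).
record Signature (ℓ : Level) : Set (suc ℓ) where
  field
    Σ₀    : Set ℓ
    Σ₁    : Set ℓ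
    ar₀   : Σ₀ → ℕ
    ar₁   : Σ₁ → ℕ
    M     : Set ℓ
    Mdcpo : M → Dcpo ℓ
    θ     : (g : Σ₁) → Fin (ar₁ g) → Maybe M

module Terms {ℓ} (Sg : Signature ℓ) where
  open Signature Sg

  -- An argument of an
  -- operator g ∈ Σ₁ at a position k with θ(g,k) = m ∈ M is an M-sorted
  -- variable or a constant of the dcpo m; at a position with θ(g,k) = *
  -- it is a term.
  mutual
    data Term : Set ℓ where
      var : ℕ → Term
      op₀ : (f : Σ₀) → (Fin (ar₀ f) → Term) → Term
      op₁ : (g : Σ₁) → ((k : Fin (ar₁ g)) → Arg (θ g k)) → Term

    data Arg : Maybe M → Set ℓ where
      star   : Term → Arg nothing
      mvar   : ∀ {m} → ℕ → Arg (just m)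
      mconst : ∀ {m} → Carrier (Mdcpo m) → Arg (just m)

  record Subst : Set ℓ where
    field
      σ  : ℕ → Term
      σM : (m : M) → ℕ → Arg (just m)

  mutual
    sub : Subst → Term → Term
    sub s (var n)    = Subst.σ s n
    sub s (op₀ f ts) = op₀ f (λ k → sub s (ts k))
    sub s (op₁ g as) = op₁ g (λ k → subArg s (as k))

    subArg : ∀ {mo} → Subst → Arg mo → Arg mo
    subArg s (star e)   = star (sub s e)
    subArg s (mvar {m} n) = Subst.σM s m n
    subArg s (mconst a) = mconst a

  data LawKind : Set where
    ineq : LawKind
    eq   : LawKind

  record Law : Set ℓ where
    field
      lhs  : Term
      rhs  : Term
      kind : LawKind

record Theory (ℓ : Level) : Set (suc ℓ) where
  field
    sig : Signature ℓ
    Λ   : Set ℓ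
    law : Λ → Terms.Law sig
  open Signature sig public
  open Terms sig public

-- Inequations deducible from the laws and monotonicity of the operations.
-- (An equation e₁ = e₂ is deducible iff both e₁ ⊑ e₂ and e₂ ⊑ e₁ are.)
module Deduction {ℓ} (T : Theory ℓ) where
  open Theory T

  mutual
    data _⊑_ : Term → Term → Set (suc ℓ) where
      ⊑-refl  : ∀ {e} → e ⊑ e
      ⊑-trans : ∀ {e₁ e₂ e₃} → e₁ ⊑ e₂ → e₂ ⊑ e₃ → e₁ ⊑ e₃
      lawˡ    : (l : Λ) (s : Subst) → sub s (Law.lhs (law l)) ⊑ sub s (Law.rhs (law l))
      lawʳ    : (l : Λ) → Law.kind (law l) ≡ eq → (s : Subst) →
                sub s (Law.rhs (law l)) ⊑ sub s (Law.lhs (law l))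
      mono₀   : ∀ f {ts us} → (∀ k → ts k ⊑ us k) → op₀ f ts ⊑ op₀ f us
      mono₁   : ∀ g {as bs} → (∀ k → ArgLe (as k) (bs k)) → op₁ g as ⊑ op₁ g bs

    data ArgLe : ∀ {mo} → Arg mo → Arg mo → Set (suc ℓ) where
      arg-refl  : ∀ {mo} {a : Arg mo} → ArgLe a a
      star-le   : ∀ {e e'} → e ⊑ e' → ArgLe (star e) (star e')
      const-le  : ∀ {m} {a b : Carrier (Mdcpo m)} → ≤⟨ Mdcpo m ⟩ a b → ArgLe (mconst a) (mconst b)

-- Ω^f : POS → SET with Ω^f P ⊆ P^|f|, and Ω^f h the restriction of h^|f|.
record OrderBoundSystem {ℓ} (T : Theory ℓ) : Set (suc ℓ) where
  open Theory T
  field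
    Ob  : (f : Σ₀) (P : Poset ℓ ℓ ℓ) → Pred (Fin (ar₀ f) → Poset.Carrier P) ℓ
    map : (f : Σ₀) {P Q : Poset ℓ ℓ ℓ} (h : PosetHomomorphism P Q) {t : Fin (ar₀ f) → Poset.Carrier P} →
          Ob f P t → Ob f Q (λ k → PosetHomomorphism.⟦_⟧ h (t k))

module Semantics {ℓ} (T : Theory ℓ) (Ω : OrderBoundSystem T) (L : Dcpo ℓ) where
  open Theory T
  open OrderBoundSystem Ω
  open Deduction T

  ArgVal : Maybe M → Set ℓ
  ArgVal nothing  = Carrier L
  ArgVal (just m) = Carrier (Mdcpo m)

  ArgValLe : (mo : Maybe M) → Rel (ArgVal mo) ℓ
  ArgValLe nothing  = ≤⟨ L ⟩
  ArgValLe (just m) = ≤⟨ Mdcpo m ⟩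

  _≤ⁿ_ : ∀ {n} → Rel (Fin n → Carrier L) ℓ
  xs ≤ⁿ ys = ∀ k → ≤⟨ L ⟩ (xs k) (ys k)

  Args : Σ₁ → Set ℓ
  Args g = (k : Fin (ar₁ g)) → ArgVal (θ g k)

  _≤ᴬ_ : ∀ {g} → Rel (Args g) ℓ
  _≤ᴬ_ {g} xs ys = ∀ k → ArgValLe (θ g k) (xs k) (ys k)

  Op₀ : Σ₀ → Set ℓ
  Op₀ f = (t : Fin (ar₀ f) → Carrier L) → Ob f (poset L) t → Carrier L

  Op₁ : Σ₁ → Set ℓ
  Op₁ g = Args g → Carrier L

  PartiallyScottContinuous : (f : Σ₀) → Op₀ f → Set (suc ℓ)
  PartiallyScottContinuous f h =
    ∀ {I : Set ℓ} (d : I → Fin (ar₀ f) → Carrier L) (ω : ∀ x → Ob f (poset L) (d x)) →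
    Directed _≤ⁿ_ d → ∀ s → IsSup _≤ⁿ_ d s → (ωs : Ob f (poset L) s) →
    IsSup (≤⟨ L ⟩) (λ x → h (d x) (ω x)) (h s ωs)

  ScottContinuous : (g : Σ₁) → Op₁ g → Set (suc ℓ)
  ScottContinuous g h =
    ∀ {I : Set ℓ} (d : I → Args g) → Directed (_≤ᴬ_ {g}) d →
    ∀ s → IsSup (_≤ᴬ_ {g}) d s → IsSup (≤⟨ L ⟩) (λ x → h (d x)) (h s)

  -- Partial evaluation of terms: Eval ρ ρM e x holds iff every occurrence
  -- of each i(f), f ∈ Σ₀, is applied to a tuple in Ω^f L, and e evaluates to x.
  module _ (i₀ : ∀ f → Op₀ f) (i₁ : ∀ g → Op₁ g)
           (ρ : ℕ → Carrier L) (ρM : (m : M) → ℕ → Carrier (Mdcpo m)) where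
    mutual
      data Eval : Term → Carrier L → Set ℓ where
        ev-var : ∀ n → Eval (var n) (ρ n)
        ev-op₀ : ∀ f {ts xs} → (∀ k → Eval (ts k) (xs k)) → (ω : Ob f (poset L) xs) →
                 Eval (op₀ f ts) (i₀ f xs ω)
        ev-op₁ : ∀ g {as vs} → (∀ k → EvalArg (as k) (vs k)) → Eval (op₁ g as) (i₁ g vs)

      data EvalArg : ∀ {mo} → Arg mo → ArgVal mo → Set ℓ where
        ev-star   : ∀ {e x} → Eval e x → EvalArg (star e) x
        ev-mvar   : ∀ {m} n → EvalArg (mvar {m = m} n) (ρM m n)
        ev-mconst : ∀ {m} (a : Carrier (Mdcpo m)) → EvalArg (mconst a) a

  SatisfiesLaws : (i₀ : ∀ f → Op₀ f) (i₁ : ∀ g → Op₁ g) → Set (suc ℓ)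
  SatisfiesLaws i₀ i₁ =
    ∀ {e e'} → e ⊑ e' → ∀ ρ ρM {x y} →
    Eval i₀ i₁ ρ ρM e x → Eval i₀ i₁ ρ ρM e' y → ≤⟨ L ⟩ x y

  -- membership in E_g(S), coordinatewise (coordinates with θ(g,k) = * lie in S)
  InE : Pred (Carrier L) ℓ → (mo : Maybe M) → ArgVal mo → Set ℓ
  InE S nothing  x = x ∈ S
  InE S (just m) x = Lift ℓ ⊤

record OBDAlgebra {ℓ} (T : Theory ℓ) (Ω : OrderBoundSystem T) : Set (suc ℓ) where
  open Theory T
  field
    L : Dcpo ℓ
  open Semantics T Ω L
  field
    i₀      : ∀ f → Op₀ f
    i₀-cont : ∀ f → PartiallyScottContinuous f (i₀ f)
    i₁      : ∀ g → Op₁ g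
    i₁-cont : ∀ g → ScottContinuous g (i₁ g)
    laws    : SatisfiesLaws i₀ i₁

record IsSubOBDAlgebra {ℓ} {T : Theory ℓ} {Ω : OrderBoundSystem T} (A : OBDAlgebra T Ω)
                       (S : Pred (Carrier (OBDAlgebra.L A)) ℓ) : Set (suc ℓ) where
  open Theory T
  open OrderBoundSystem Ω
  open OBDAlgebra A
  open Semantics T Ω L

  field
    subdcpo : SubDcpo L S
    closed₀ : ∀ f (t : Fin (ar₀ f) → Σ (Carrier L) S) (ω : Ob f (subPoset L S) t) →
              i₀ f (λ k → proj₁ (t k)) (map f (incl L S) ω) ∈ S
    closed₁ : ∀ g (a : Args g) → (∀ k → InE S (θ g k) (a k)) → i₁ g a ∈ S

{-# OPTIONS --safe #-}
-- Each closure condition on S passes to every subset of S, so it passes to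
-- the intersection from any member of the family.  The one subtlety is that
-- the condition for f ∈ Σ₀ is stated with a particular witness of membership
-- in Ω^f L; partial Scott continuity applied to a constant family shows that
-- i(f) does not depend on that witness.
module Submission where

open import Defs
open import Function using (_∘_)
open import Level using (Level; Lift; lift)
open import Data.Unit using (⊤; tt)
open import Data.Maybe using (just; nothing)
open import Data.Fin using (Fin)
open import Data.Product using (Σ; _,_; proj₁; proj₂)
open import Relation.Unary using (Pred; _∈_; _⊆_; ⋂)
open import Relation.Binary using (Rel; Reflexive; IsPartialOrder)
open import Relation.Binary.PropositionalEquality using (_≡_; subst)
open import Relation.Binary.Morphism.Bundles using (PosetHomomorphism; mkPosetHomo)

module _ {a r ℓ : Level} {A : Set a} {_≤_ : Rel A r} (≤-refl : Reflexive _≤_) (x : A) where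

  const-directed : Directed _≤_ (λ (_ : Lift ℓ ⊤) → x)
  const-directed = lift tt , λ _ _ → lift tt , ≤-refl , ≤-refl

  const-isSup : IsSup _≤_ (λ (_ : Lift ℓ ⊤) → x) x
  const-isSup = (λ _ → ≤-refl) , λ _ ub → ub (lift tt)

⋂-subDcpo : ∀ {ℓ} (L : Dcpo ℓ) {J : Set ℓ} (S : J → Pred (Dcpo.Carrier L) ℓ) →
            (∀ j → SubDcpo L (S j)) → SubDcpo L (⋂ J S)
⋂-subDcpo L S sub d dir d∈⋂ s sup j = sub j d dir (λ x → d∈⋂ x j) s sup

module _ {ℓ} (T : Theory ℓ) (Ω : OrderBoundSystem T) (L : Dcpo ℓ) where
  open Theory T
  open OrderBoundSystem Ω
  open Semantics T Ω L
  open IsPartialOrder (Dcpo.isPartialOrder L) using (antisym) renaming (refl to ≤-refl)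

  continuous⇒witness-irrelevant : ∀ {f} {h : Op₀ f} → PartiallyScottContinuous f h →
                                  ∀ {t} (ω ω′ : Ob f (Dcpo.poset L) t) → h t ω ≡ h t ω′
  continuous⇒witness-irrelevant {f} {h} cont {t} ω ω′ = antisym (h-≤ ω ω′) (h-≤ ω′ ω)
    where
    ≤ⁿ-refl : Reflexive (_≤ⁿ_ {ar₀ f})
    ≤ⁿ-refl _ = ≤-refl

    h-≤ : ∀ ω ω′ → Dcpo._≤_ L (h t ω) (h t ω′)
    h-≤ ω ω′ = proj₁ (cont (λ _ → t) (λ _ → ω) (const-directed {ℓ = ℓ} {_≤_ = _≤ⁿ_} ≤ⁿ-refl t)
                           t (const-isSup {ℓ = ℓ} {_≤_ = _≤ⁿ_} ≤ⁿ-refl t) ω′) (lift tt)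

  ⊆⇒subPosetHomomorphism : ∀ {S S′ : Pred (Dcpo.Carrier L) ℓ} → S ⊆ S′ →
                           PosetHomomorphism (subPoset L S) (subPoset L S′)
  ⊆⇒subPosetHomomorphism S⊆S′ = mkPosetHomo _ _ (λ (x , x∈S) → x , S⊆S′ x∈S) (λ x≤y → x≤y)

  InE-mono : ∀ {S S′ : Pred (Dcpo.Carrier L) ℓ} → S ⊆ S′ →
             ∀ mo {x} → InE S mo x → InE S′ mo x
  InE-mono S⊆S′ nothing  x∈S = S⊆S′ x∈S
  InE-mono _     (just _) x∈E = x∈E

module _ {ℓ} {T : Theory ℓ} {Ω : OrderBoundSystem T} (A : OBDAlgebra T Ω) where
  open Theory T
  open OrderBoundSystem Ω
  open OBDAlgebra A
  open Semantics T Ω L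
  open IsSubOBDAlgebra

  closed₀-⊆ : ∀ {S S′} → S ⊆ S′ → IsSubOBDAlgebra A S′ →
              ∀ f (t : Fin (ar₀ f) → Σ (Dcpo.Carrier L) S) (ω : Ob f (subPoset L S) t) →
              i₀ f (proj₁ ∘ t) (map f (incl L S) ω) ∈ S′
  closed₀-⊆ {S′ = S′} S⊆S′ sub f t ω =
    subst (_∈ S′) (continuous⇒witness-irrelevant T Ω L (i₀-cont f) _ _)
          (closed₀ sub f (λ k → proj₁ (t k) , S⊆S′ (proj₂ (t k)))
                         (map f (⊆⇒subPosetHomomorphism T Ω L S⊆S′) ω))

  closed₁-⊆ : ∀ {S S′} → S ⊆ S′ → IsSubOBDAlgebra A S′ →
              ∀ g (a : Args g) → (∀ k → InE S (θ g k) (a k)) → i₁ g a ∈ S′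
  closed₁-⊆ S⊆S′ sub g a a∈E = closed₁ sub g a (λ k → InE-mono T Ω L S⊆S′ (θ g k) (a∈E k))

-- The empty intersection is the whole carrier.
proposition3p3 : ∀ {ℓ} (T : Theory ℓ) (Ω : OrderBoundSystem T) (A : OBDAlgebra T Ω)
                 (J : Set ℓ) → J → (S : J → Pred (Dcpo.Carrier (OBDAlgebra.L A)) ℓ) →
                 (∀ j → IsSubOBDAlgebra A (S j)) →
                 IsSubOBDAlgebra A (λ x → ∀ j → S j x)
proposition3p3 T Ω A J _ S sub = record
  { subdcpo = ⋂-subDcpo (OBDAlgebra.L A) S (IsSubOBDAlgebra.subdcpo ∘ sub)
  ; closed₀ = λ f t ω j → closed₀-⊆ A (⋂⊆ j) (sub j) f t ω
  ; closed₁ = λ g a a∈E j → closed₁-⊆ A (⋂⊆ j) (sub j) g a a∈E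
  }
  where
  ⋂⊆ : ∀ j → ⋂ J S ⊆ S j
  ⋂⊆ j x∈⋂ = x∈⋂ j
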